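{- Let $N$ be a positive integer and $f\colon\mathbb{Z}_{>0}\to\mathbb{C}$ a function of Lefschetz type. Define $f_N(m)\coloneqq f(\mathrm{lcm}(N,m))^{\gcd(N,m)}$ for $m\in\mathbb{Z}_{>0}$. Then $f_N$ is of Lefschetz type.
   Context: A function $f\colon\mathbb{Z}_{>0}\to\mathbb{C}$ is of Lefschetz type if there exist $n_1,\dots,n_r\in\mathbb{Z}$ and $\alpha_1,\dots,\alpha_r\in\mathbb{C}$ with $f(m)=\sum_{i=1}^r n_i\alpha_i^m$ for all $m\in\mathbb{Z}_{>0}$. -}

module Defs where

open import Level using (Level; _⊔_)
open import Algebra.Bundles using (CommutativeRing)
open import Data.Nat as ℕ using (ℕ; zero; suc; NonZero)
open import Data.Nat.GCD using (gcd)
open import Data.Nat.LCM using (lcm)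
open import Data.Integer as ℤ using (ℤ; +_; -[1+_])
open import Data.Fin using (Fin; zero; suc; toℕ)
open import Data.List using (List; []; _∷_)
open import Data.Product using (Σ; ∃; _×_; _,_)
open import Relation.Nullary using (¬_)

module _ {c ℓ : Level} (K : CommutativeRing c ℓ) where
  open CommutativeRing K hiding (zero)

  pow : Carrier → ℕ → Carrier
  pow x zero    = 1#
  pow x (suc m) = x * pow x m

  natMul : ℕ → Carrier → Carrier
  natMul zero    x = 0#
  natMul (suc n) x = x + natMul n x

  intMul : ℤ → Carrier → Carrier
  intMul (+ n)      x = natMul n x
  intMul -[1+ n ]   x = - natMul (suc n) x

  sumFin : (n : ℕ) → (Fin n → Carrier) → Carrier
  sumFin zero    g = 0#
  sumFin (suc n) g = g zero + sumFin n (λ i → g (suc i))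

  IsField : Set (c ⊔ ℓ)
  IsField = (¬ (1# ≈ 0#)) × (∀ x → ¬ (x ≈ 0#) → ∃ λ y → x * y ≈ 1#)

  CharZero : Set ℓ
  CharZero = ∀ n → ¬ (natMul (suc n) 1# ≈ 0#)

  AlgClosed : Set (c ⊔ ℓ)
  AlgClosed = ∀ n (a : Fin (suc n) → Carrier) →
    ∃ λ x → pow x (suc n) + sumFin (suc n) (λ i → a i * pow x (toℕ i)) ≈ 0#

  -- f : ℤ_{>0} → K is of Lefschetz type (values at 0 are irrelevant)
  IsLefschetzType : (ℕ → Carrier) → Set (c ⊔ ℓ)
  IsLefschetzType f =
    Σ ℕ λ r → Σ (Fin r → ℤ) λ n → Σ (Fin r → Carrier) λ α →
      ∀ (m : ℕ) → .{{_ : NonZero m}} →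
        f m ≈ sumFin r (λ i → intMul (n i) (pow (α i) m))

  fN : ℕ → (ℕ → Carrier) → ℕ → Carrier
  fN N f m = pow (f (lcm N m)) (gcd N m)

-- Write N = p·M with p prime and induct on the number of prime factors of N. Put
-- h := (m ↦ f (p·m))_M, of Lefschetz type by induction. Then f_N(m) = h(m) when p ∤ m, and
-- f_N(p·m) = h(m)^p. Expanding by the binomial theorem, where p divides every inner binomial
-- coefficient, gives h(m)^p = h(p·m) + p·s(m) with s of Lefschetz type. It remains to show that
-- m ↦ p·s(m/p) (taken as 0 when p ∤ m) is of Lefschetz type. For s(m) = α^m this is
-- Σ_j (ζ^j β)^m, where β^p = α and ζ is a primitive p-th root of unity: these exist because the
-- field is algebraically closed of characteristic zero. So f_N = h + (that function).
module Submission where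

open import Level using (Level; _⊔_)
open import Algebra.Bundles using (CommutativeRing)
open import Data.Nat as ℕ using (ℕ; zero; suc; NonZero; NonTrivial; _∸_; _<_; _≤_; _!; z<s; s<s)
open import Data.Nat.Properties as ℕ using (m*n≢0; m*n≢0⇒m≢0; n∸n≡0)
open import Data.Nat.Divisibility using (_∣_; _∤_; _∣?_; divides; m∣m*n)
open import Data.Nat.DivMod using (_/_; m*[n/m]≡n)
open import Data.Nat.GCD using (gcd; module Bézout; c*gcd[m,n]≡gcd[cm,cn]; gcd-zeroˡ)
open import Data.Nat.LCM using (lcm)
open import Data.Nat.Coprimality using (Coprime; coprime-Bézout)
open import Data.Nat.Primality using (Prime; prime⇒nonZero; prime⇒nonTrivial)
open import Data.Nat.Primality.Factorisation using (factorise; PrimeFactorisation)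
open import Data.Nat.Combinatorics using (_C_; nCn≡1)
open import Data.Nat.ListAction using (product)
open import Data.Integer as ℤ using (ℤ)
open import Data.Fin using (Fin; zero; suc; toℕ; inject₁; fromℕ)
open import Data.Fin.Properties using (toℕ-inject₁; toℕ-fromℕ; toℕ<n)
open import Data.List using (List; []; _∷_; _++_; map; length; lookup)
open import Data.List.Relation.Unary.All using (All; []; _∷_)
open import Data.Product using (Σ-syntax; _,_; proj₁; proj₂)
open import Data.Sum using (inj₁; inj₂)
open import Function using (_∘_)
open import Relation.Nullary using (¬_; yes; no; contradiction)
open import Relation.Binary.PropositionalEquality as ≡ using (_≡_)

open import Defs

module _ where
  open import Data.Nat using (_*_)
  open import Data.Product using (_×_)
  open import Data.Nat.Properties
    using (*-assoc; *-cancelˡ-≡; <⇒≤; <⇒≱; m≤n⇒m≤1+n; ∸-monoʳ-<; _!*_!≢0; *-commutativeSemigroup)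
  open import Data.Nat.Divisibility using (∣-trans; n∣m*n; ∣⇒≤; ∣1⇒≡1)
  open import Data.Nat.DivMod using (m/n*n≡m)
  open import Data.Nat.GCD using (module GCD; gcd-GCD; gcd[m,n]∣m; gcd[m,n]∣n; gcd-greatest;
                                  gcd[m,n]≢0)
  open import Data.Nat.LCM using (gcd*lcm)
  open import Data.Nat.Coprimality using (coprime-divisor)
  open import Data.Nat.Primality using (prime⇒irreducible; euclidsLemma; ¬prime[1])
  open import Data.Nat.Combinatorics using (k![n∸k]!∣n!)
  open import Data.Nat.Combinatorics.Specification using (nCk≡n!/k![n-k]!)
  open import Algebra.Properties.CommutativeSemigroup *-commutativeSemigroup
    using (x∙yz≈y∙xz; interchange)
  open ≡ using (refl; sym; trans; cong; subst)
  open ≡.≡-Reasoning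

  prime∤⇒coprime : ∀ {p n} → Prime p → p ∤ n → Coprime p n
  prime∤⇒coprime p-prime p∤n (d∣p , d∣n) with prime⇒irreducible p-prime d∣p
  ... | inj₁ d≡1  = d≡1
  ... | inj₂ refl = contradiction d∣n p∤n

  gcd[cm,n]≡gcd[m,n] : ∀ {c n} m → Coprime c n → gcd (c * m) n ≡ gcd m n
  gcd[cm,n]≡gcd[m,n] {c} {n} m c⊥n = GCD.unique (gcd-GCD (c * m) n)
    (GCD.is (∣-trans (gcd[m,n]∣m m n) (n∣m*n c) , gcd[m,n]∣n m n) greatest)
    where
    greatest : ∀ {d} → d ∣ c * m × d ∣ n → d ∣ gcd m n
    greatest (d∣cm , d∣n) =
      gcd-greatest (coprime-divisor (λ (i∣d , i∣c) → c⊥n (i∣c , ∣-trans i∣d d∣n)) d∣cm) d∣n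

  gcd-nonZeroʳ : ∀ m n .{{_ : NonZero n}} → NonZero (gcd m n)
  gcd-nonZeroʳ m n = ℕ.≢-nonZero (gcd[m,n]≢0 m n (inj₂ (ℕ.≢-nonZero⁻¹ n)))

  gcd*l≡m*n⇒lcm≡l : ∀ m n {l} .{{_ : NonZero (gcd m n)}} → gcd m n * l ≡ m * n → lcm m n ≡ l
  gcd*l≡m*n⇒lcm≡l m n eq = *-cancelˡ-≡ (lcm m n) _ (gcd m n) (trans (gcd*lcm m n) (sym eq))

  lcm[1,n]≡n : ∀ n .{{_ : NonZero n}} → lcm 1 n ≡ n
  lcm[1,n]≡n n = gcd*l≡m*n⇒lcm≡l 1 n {{gcd-nonZeroʳ 1 n}} (cong (_* n) (gcd-zeroˡ n))

  lcm[cm,n]≡c*lcm[m,n] : ∀ {c n} m .{{_ : NonZero n}} → Coprime c n → lcm (c * m) n ≡ c * lcm m n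
  lcm[cm,n]≡c*lcm[m,n] {c} {n} m c⊥n = gcd*l≡m*n⇒lcm≡l (c * m) n {{gcd-nonZeroʳ (c * m) n}} (begin
    gcd (c * m) n * (c * lcm m n) ≡⟨ cong (_* (c * lcm m n)) (gcd[cm,n]≡gcd[m,n] m c⊥n) ⟩
    gcd m n * (c * lcm m n)       ≡⟨ x∙yz≈y∙xz (gcd m n) c (lcm m n) ⟩
    c * (gcd m n * lcm m n)       ≡⟨ cong (c *_) (gcd*lcm m n) ⟩
    c * (m * n)                   ≡⟨ *-assoc c m n ⟨
    c * m * n                     ∎)

  lcm[cm,cn]≡c*lcm[m,n] : ∀ c m n .{{_ : NonZero c}} .{{_ : NonZero n}} →
                          lcm (c * m) (c * n) ≡ c * lcm m n
  lcm[cm,cn]≡c*lcm[m,n] c m n =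
    gcd*l≡m*n⇒lcm≡l (c * m) (c * n) {{gcd-nonZeroʳ (c * m) (c * n) {{m*n≢0 c n}}}} (begin
      gcd (c * m) (c * n) * (c * lcm m n) ≡⟨ cong (_* (c * lcm m n)) (c*gcd[m,n]≡gcd[cm,cn] c m n) ⟨
      c * gcd m n * (c * lcm m n)         ≡⟨ interchange c (gcd m n) c (lcm m n) ⟩
      c * c * (gcd m n * lcm m n)         ≡⟨ cong (c * c *_) (gcd*lcm m n) ⟩
      c * c * (m * n)                     ≡⟨ interchange c c m n ⟩
      c * m * (c * n)                     ∎)

  prime∣n!⇒p≤n : ∀ {p} n → Prime p → p ∣ n ! → p ≤ n
  prime∣n!⇒p≤n zero    p-prime p∣1 =
    contradiction (subst Prime (∣1⇒≡1 p∣1) p-prime) ¬prime[1]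
  prime∣n!⇒p≤n (suc n) p-prime p∣n! with euclidsLemma (suc n) (n !) p-prime p∣n!
  ... | inj₁ p∣1+n = ∣⇒≤ p∣1+n
  ... | inj₂ p∣n!  = m≤n⇒m≤1+n (prime∣n!⇒p≤n n p-prime p∣n!)

  -- p divides p! = (p C k) · k! · (p ∸ k)!, but neither of the two factorials.
  prime∣pCk : ∀ {p k} → Prime p → 0 < k → k < p → p ∣ p C k
  prime∣pCk {p@(suc n)} {k} p-prime 0<k k<p
    with euclidsLemma (p C k) (k ! * (p ∸ k) !) p-prime p∣pCk*k!*[p∸k]!
    where
    pCk*k!*[p∸k]!≡p! : (p C k) * (k ! * (p ∸ k) !) ≡ p !
    pCk*k!*[p∸k]!≡p! = trans (cong (_* (k ! * (p ∸ k) !)) (nCk≡n!/k![n-k]! (<⇒≤ k<p)))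
                             (m/n*n≡m {{k !* (p ∸ k) !≢0}} (k![n∸k]!∣n! (<⇒≤ k<p)))
    p∣pCk*k!*[p∸k]! : p ∣ (p C k) * (k ! * (p ∸ k) !)
    p∣pCk*k!*[p∸k]! = subst (p ∣_) (sym pCk*k!*[p∸k]!≡p!) (m∣m*n (n !))
  ... | inj₁ p∣pCk = p∣pCk
  ... | inj₂ p∣k!*[p∸k]! with euclidsLemma (k !) ((p ∸ k) !) p-prime p∣k!*[p∸k]!
  ...   | inj₁ p∣k!     = contradiction (prime∣n!⇒p≤n k p-prime p∣k!) (<⇒≱ k<p)
  ...   | inj₂ p∣[p∸k]! = contradiction (prime∣n!⇒p≤n (p ∸ k) p-prime p∣[p∸k]!)
                                        (<⇒≱ (∸-monoʳ-< 0<k (<⇒≤ k<p)))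

module _ {c ℓ : Level} (K : CommutativeRing c ℓ) where
  open CommutativeRing K hiding (zero)
  open import Algebra.Properties.Ring ring
    using (-‿distribˡ-*; -‿distribʳ-*; -‿involutive; -0#≈0#; -‿+-comm;
           +-inverseˡ-unique; +-identityˡ-unique; x∙y⁻¹≈ε⇒x≈y)
  open import Algebra.Properties.CommutativeSemigroup +-commutativeSemigroup
    using (interchange; xy∙z≈y∙xz)
  open import Algebra.Properties.CommutativeSemigroup *-commutativeSemigroup
    using () renaming (x∙yz≈y∙xz to *-x∙yz≈y∙xz)
  open import Algebra.Properties.Semiring.Exp semiring using (_^_; ^-congˡ; ^-congʳ; ^-assocʳ)
  open import Algebra.Properties.CommutativeSemiring.Exp commutativeSemiring using (^-distrib-*)
  open import Algebra.Properties.Semiring.Mult semiring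
    using (_×_; ×-congˡ; ×-congʳ; ×-assocˡ; ×-assoc-*)
  open import Algebra.Properties.CommutativeMonoid.Mult +-commutativeMonoid using (×-distrib-+)
  open import Algebra.Properties.Monoid.Sum +-monoid
    using (sum; sum-syntax; sum-cong-≋; sum-init-last; sum-replicate-zero)
  open import Algebra.Properties.Semiring.Sum semiring using (*-distribˡ-sum)
  open import Algebra.Properties.CommutativeSemiring.Binomial commutativeSemiring
    using (binomialTerm) renaming (theorem to binomial-theorem)
  open import Relation.Binary.Reasoning.Setoid setoid

  private variable f g : ℕ → Carrier

  pow≡^ : ∀ x n → pow K x n ≡ x ^ n
  pow≡^ x zero    = ≡.refl
  pow≡^ x (suc n) = ≡.cong (x *_) (pow≡^ x n)

  natMul≡× : ∀ n x → natMul K n x ≡ n × x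
  natMul≡× zero    x = ≡.refl
  natMul≡× (suc n) x = ≡.cong (x +_) (natMul≡× n x)

  sumFin≡sum : ∀ n (g : Fin n → Carrier) → sumFin K n g ≡ sum g
  sumFin≡sum zero    g = ≡.refl
  sumFin≡sum (suc n) g = ≡.cong (g zero +_) (sumFin≡sum n (g ∘ suc))

  1#^n≈1# : ∀ n → 1# ^ n ≈ 1#
  1#^n≈1# zero    = refl
  1#^n≈1# (suc n) = trans (*-identityˡ _) (1#^n≈1# n)

  0#^n≈0# : ∀ n .{{_ : NonZero n}} → 0# ^ n ≈ 0#
  0#^n≈0# (suc n) = zeroˡ _

  ^-comm : ∀ x m n → (x ^ m) ^ n ≈ (x ^ n) ^ m
  ^-comm x m n = begin
    (x ^ m) ^ n   ≈⟨ ^-assocʳ x m n ⟩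
    x ^ (m ℕ.* n) ≡⟨ ≡.cong (x ^_) (ℕ.*-comm m n) ⟩
    x ^ (n ℕ.* m) ≈⟨ ^-assocʳ x n m ⟨
    (x ^ n) ^ m   ∎

  ×-zeroʳ : ∀ n → n × 0# ≈ 0#
  ×-zeroʳ zero    = refl
  ×-zeroʳ (suc n) = trans (+-identityˡ _) (×-zeroʳ n)

  ×-neg : ∀ n x → n × (- x) ≈ - (n × x)
  ×-neg zero    x = sym -0#≈0#
  ×-neg (suc n) x = trans (+-congˡ (×-neg n x)) (-‿+-comm _ _)

  ×-distrib-sum : ∀ k {n} (g : Fin n → Carrier) → k × sum g ≈ ∑[ i < n ] (k × g i)
  ×-distrib-sum k {zero}  g = ×-zeroʳ k
  ×-distrib-sum k {suc n} g =
    trans (×-distrib-+ (g zero) (sum (g ∘ suc)) k) (+-congˡ (×-distrib-sum k (g ∘ suc)))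

  -- Power sums

  -- A coefficient n ∈ ℤ of αᵐ is represented by |n| copies of a term of the sign of n.
  data Term : Set c where
    pos neg : Carrier → Term

  ⟦_⟧ : Term → ℕ → Carrier
  ⟦ pos α ⟧ m = α ^ m
  ⟦ neg α ⟧ m = - (α ^ m)

  powerSum : List Term → ℕ → Carrier
  powerSum []       m = 0#
  powerSum (t ∷ ts) m = ⟦ t ⟧ m + powerSum ts m

  infix 4 _≈⁺_
  _≈⁺_ : (ℕ → Carrier) → (ℕ → Carrier) → Set ℓ
  f ≈⁺ g = ∀ m → .{{_ : NonZero m}} → f m ≈ g m

  IsPowerSum : (ℕ → Carrier) → Set (c ⊔ ℓ)
  IsPowerSum f = Σ[ ts ∈ List Term ] f ≈⁺ powerSum ts

  isPowerSum-resp : f ≈⁺ g → IsPowerSum f → IsPowerSum g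
  isPowerSum-resp f≈g (ts , f≈ts) = ts , λ m → trans (sym (f≈g m)) (f≈ts m)

  isPowerSum-0 : IsPowerSum (λ _ → 0#)
  isPowerSum-0 = [] , λ _ → refl

  isPowerSum-exp : ∀ α → IsPowerSum (α ^_)
  isPowerSum-exp α = pos α ∷ [] , λ _ → sym (+-identityʳ _)

  powerSum-++ : ∀ ts us m → powerSum (ts ++ us) m ≈ powerSum ts m + powerSum us m
  powerSum-++ []       us m = sym (+-identityˡ _)
  powerSum-++ (t ∷ ts) us m = trans (+-congˡ (powerSum-++ ts us m)) (sym (+-assoc _ _ _))

  isPowerSum-+ : IsPowerSum f → IsPowerSum g → IsPowerSum (λ m → f m + g m)
  isPowerSum-+ (ts , f≈ts) (us , g≈us) =
    ts ++ us , λ m → trans (+-cong (f≈ts m) (g≈us m)) (sym (powerSum-++ ts us m))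

  negate : Term → Term
  negate (pos α) = neg α
  negate (neg α) = pos α

  ⟦negate⟧ : ∀ t m → ⟦ negate t ⟧ m ≈ - ⟦ t ⟧ m
  ⟦negate⟧ (pos α) m = refl
  ⟦negate⟧ (neg α) m = sym (-‿involutive _)

  powerSum-negate : ∀ ts m → powerSum (map negate ts) m ≈ - powerSum ts m
  powerSum-negate []       m = sym -0#≈0#
  powerSum-negate (t ∷ ts) m = trans (+-cong (⟦negate⟧ t m) (powerSum-negate ts m)) (-‿+-comm _ _)

  isPowerSum-neg : IsPowerSum f → IsPowerSum (λ m → - f m)
  isPowerSum-neg (ts , f≈ts) =
    map negate ts , λ m → trans (-‿cong (f≈ts m)) (sym (powerSum-negate ts m))

  _⊗_ : Term → Term → Term
  pos α ⊗ pos β = pos (α * β)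
  pos α ⊗ neg β = neg (α * β)
  neg α ⊗ pos β = neg (α * β)
  neg α ⊗ neg β = pos (α * β)

  ⟦⊗⟧ : ∀ s t m → ⟦ s ⊗ t ⟧ m ≈ ⟦ s ⟧ m * ⟦ t ⟧ m
  ⟦⊗⟧ (pos α) (pos β) m = ^-distrib-* α β m
  ⟦⊗⟧ (pos α) (neg β) m = trans (-‿cong (^-distrib-* α β m)) (-‿distribʳ-* _ _)
  ⟦⊗⟧ (neg α) (pos β) m = trans (-‿cong (^-distrib-* α β m)) (-‿distribˡ-* _ _)
  ⟦⊗⟧ (neg α) (neg β) m = begin
    (α * β) ^ m           ≈⟨ ^-distrib-* α β m ⟩
    α ^ m * β ^ m         ≈⟨ -‿involutive _ ⟨
    - - (α ^ m * β ^ m)   ≈⟨ -‿cong (-‿distribˡ-* _ _) ⟩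
    - (- (α ^ m) * β ^ m) ≈⟨ -‿distribʳ-* _ _ ⟩
    - (α ^ m) * - (β ^ m) ∎

  _⊛_ : List Term → List Term → List Term
  []       ⊛ us = []
  (t ∷ ts) ⊛ us = map (t ⊗_) us ++ ts ⊛ us

  powerSum-map-⊗ : ∀ t us m → powerSum (map (t ⊗_) us) m ≈ ⟦ t ⟧ m * powerSum us m
  powerSum-map-⊗ t []       m = sym (zeroʳ _)
  powerSum-map-⊗ t (u ∷ us) m =
    trans (+-cong (⟦⊗⟧ t u m) (powerSum-map-⊗ t us m)) (sym (distribˡ _ _ _))

  powerSum-⊛ : ∀ ts us m → powerSum (ts ⊛ us) m ≈ powerSum ts m * powerSum us m
  powerSum-⊛ []       us m = sym (zeroˡ _)
  powerSum-⊛ (t ∷ ts) us m = begin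
    powerSum (map (t ⊗_) us ++ ts ⊛ us) m
      ≈⟨ powerSum-++ (map (t ⊗_) us) (ts ⊛ us) m ⟩
    powerSum (map (t ⊗_) us) m + powerSum (ts ⊛ us) m
      ≈⟨ +-cong (powerSum-map-⊗ t us m) (powerSum-⊛ ts us m) ⟩
    ⟦ t ⟧ m * powerSum us m + powerSum ts m * powerSum us m
      ≈⟨ distribʳ _ _ _ ⟨
    (⟦ t ⟧ m + powerSum ts m) * powerSum us m
      ∎

  isPowerSum-* : IsPowerSum f → IsPowerSum g → IsPowerSum (λ m → f m * g m)
  isPowerSum-* (ts , f≈ts) (us , g≈us) =
    ts ⊛ us , λ m → trans (*-cong (f≈ts m) (g≈us m)) (sym (powerSum-⊛ ts us m))

  isPowerSum-^ : ∀ k → IsPowerSum f → IsPowerSum (λ m → f m ^ k)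
  isPowerSum-^ zero    _    = isPowerSum-resp (λ m → 1#^n≈1# m) (isPowerSum-exp 1#)
  isPowerSum-^ (suc k) f-ps = isPowerSum-* f-ps (isPowerSum-^ k f-ps)

  isPowerSum-× : ∀ k → IsPowerSum f → IsPowerSum (λ m → k × f m)
  isPowerSum-× zero    _    = isPowerSum-0
  isPowerSum-× (suc k) f-ps = isPowerSum-+ f-ps (isPowerSum-× k f-ps)

  isPowerSum-sum : ∀ n {F : Fin n → ℕ → Carrier} →
                   (∀ i → IsPowerSum (F i)) → IsPowerSum (λ m → ∑[ i < n ] F i m)
  isPowerSum-sum zero    _    = isPowerSum-0
  isPowerSum-sum (suc n) F-ps = isPowerSum-+ (F-ps zero) (isPowerSum-sum n (F-ps ∘ suc))

  isPowerSum-ind : ∀ {a} (P : (ℕ → Carrier) → Set a) →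
                   (∀ {f g} → f ≈⁺ g → P f → P g) →
                   P (λ _ → 0#) →
                   (∀ α → P (α ^_)) →
                   (∀ {f g} → IsPowerSum f → IsPowerSum g →
                              P f → P g → P (λ m → f m + g m)) →
                   (∀ {f} → IsPowerSum f → P f → P (λ m → - f m)) →
                   IsPowerSum f → P f
  isPowerSum-ind P P-resp P-0 P-exp P-+ P-neg (ts , f≈ts) = P-resp (λ m → sym (f≈ts m)) (go ts)
    where
    go : ∀ ts → P (powerSum ts)
    go []           = P-0
    go (pos α ∷ ts) = P-+ (isPowerSum-exp α) (ts , λ _ → refl) (P-exp α) (go ts)
    go (neg α ∷ ts) = P-+ (isPowerSum-neg (isPowerSum-exp α)) (ts , λ _ → refl)
                          (P-neg (isPowerSum-exp α) (P-exp α)) (go ts)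

  isPowerSum-∘* : ∀ k .{{_ : NonZero k}} → IsPowerSum f → IsPowerSum (λ m → f (k ℕ.* m))
  isPowerSum-∘* k = isPowerSum-ind (λ f → IsPowerSum (λ m → f (k ℕ.* m)))
    (λ f≈g → isPowerSum-resp (λ m → f≈g (k ℕ.* m) {{m*n≢0 k m}}))
    isPowerSum-0
    (λ α → isPowerSum-resp (λ m → ^-assocʳ α k m) (isPowerSum-exp (α ^ k)))
    (λ _ _ → isPowerSum-+)
    (λ _ → isPowerSum-neg)

  isPowerSum-intMul : ∀ z → IsPowerSum f → IsPowerSum (λ m → intMul K z (f m))
  isPowerSum-intMul (ℤ.+ k)     f-ps =
    isPowerSum-resp (λ m → reflexive (≡.sym (natMul≡× k _))) (isPowerSum-× k f-ps)
  isPowerSum-intMul ℤ.-[1+ k ] f-ps =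
    isPowerSum-resp (λ m → -‿cong (reflexive (≡.sym (natMul≡× (suc k) _))))
                    (isPowerSum-neg (isPowerSum-× (suc k) f-ps))

  isLefschetzType⇒isPowerSum : IsLefschetzType K f → IsPowerSum f
  isLefschetzType⇒isPowerSum (r , n , α , f≈) =
    isPowerSum-resp (λ m → sym (trans (f≈ m) (reflexive (sumFin≡sum r _))))
      (isPowerSum-sum r λ i → isPowerSum-intMul (n i)
        (isPowerSum-resp (λ m → reflexive (≡.sym (pow≡^ (α i) m))) (isPowerSum-exp (α i))))

  coefficient : Term → ℤ
  coefficient (pos _) = ℤ.+ 1
  coefficient (neg _) = ℤ.-[1+ 0 ]

  base : Term → Carrier
  base (pos α) = α
  base (neg α) = α

  intMul-coefficient : ∀ t m → intMul K (coefficient t) (pow K (base t) m) ≈ ⟦ t ⟧ m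
  intMul-coefficient (pos α) m = trans (+-identityʳ _) (reflexive (pow≡^ α m))
  intMul-coefficient (neg α) m = -‿cong (trans (+-identityʳ _) (reflexive (pow≡^ α m)))

  powerSum≈sumFin : ∀ ts m → powerSum ts m ≈
    sumFin K (length ts) (λ i → intMul K (coefficient (lookup ts i)) (pow K (base (lookup ts i)) m))
  powerSum≈sumFin []       m = refl
  powerSum≈sumFin (t ∷ ts) m = +-cong (sym (intMul-coefficient t m)) (powerSum≈sumFin ts m)

  isPowerSum⇒isLefschetzType : IsPowerSum f → IsLefschetzType K f
  isPowerSum⇒isLefschetzType (ts , f≈ts) =
    length ts , coefficient ∘ lookup ts , base ∘ lookup ts ,
    λ m → trans (f≈ts m) (powerSum≈sumFin ts m)

  -- The Frobenius congruence

  binomialTerm-last : ∀ x y n → binomialTerm x y n (fromℕ n) ≈ x ^ n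
  binomialTerm-last x y n rewrite toℕ-fromℕ n | nCn≡1 n | n∸n≡0 n =
    trans (+-identityʳ _) (*-identityʳ _)

  binomial-split : ∀ n x y → (x + y) ^ suc n ≈ x ^ suc n + y ^ suc n +
                   ∑[ j < n ] ((suc n C suc (toℕ j)) × (x ^ suc (toℕ j) * y ^ (n ∸ toℕ j)))
  binomial-split n x y = begin
    (x + y) ^ suc n
      ≈⟨ binomial-theorem (suc n) x y ⟩
    T zero + sum (T ∘ suc)
      ≈⟨ +-congˡ (sum-init-last (T ∘ suc)) ⟩
    T zero + (sum (T ∘ suc ∘ inject₁) + T (fromℕ (suc n)))
      ≈⟨ +-cong (trans (+-identityʳ _) (*-identityˡ _))
                (+-cong (sum-cong-≋ inner) (binomialTerm-last x y (suc n))) ⟩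
    y ^ suc n + (S + x ^ suc n)
      ≈⟨ +-congˡ (+-comm _ _) ⟩
    y ^ suc n + (x ^ suc n + S)
      ≈⟨ +-assoc _ _ _ ⟨
    y ^ suc n + x ^ suc n + S
      ≈⟨ +-congʳ (+-comm _ _) ⟩
    x ^ suc n + y ^ suc n + S
      ∎
    where
    T = binomialTerm x y (suc n)
    term : ℕ → Carrier
    term k = (suc n C suc k) × (x ^ suc k * y ^ (n ∸ k))
    S = ∑[ j < n ] term (toℕ j)
    inner : ∀ j → T (suc (inject₁ j)) ≈ term (toℕ j)
    inner j = reflexive (≡.cong term (toℕ-inject₁ j))

  binomialRemainder : (p : ℕ) .{{_ : NonZero p}} → Carrier → Carrier → Carrier
  binomialRemainder p x y =
    ∑[ j < ℕ.pred p ] (((p C suc (toℕ j)) / p) × (x ^ suc (toℕ j) * y ^ (ℕ.pred p ∸ toℕ j)))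

  binomial-prime : ∀ {p} .{{_ : NonZero p}} → Prime p → ∀ x y →
                   (x + y) ^ p ≈ x ^ p + y ^ p + p × binomialRemainder p x y
  binomial-prime {p@(suc n)} p-prime x y = begin
    (x + y) ^ p
      ≈⟨ binomial-split n x y ⟩
    x ^ p + y ^ p + ∑[ j < n ] ((p C suc (toℕ j)) × monomial j)
      ≈⟨ +-congˡ (sum-cong-≋ divisible) ⟩
    x ^ p + y ^ p + ∑[ j < n ] (p × quotientTerm j)
      ≈⟨ +-congˡ (×-distrib-sum p quotientTerm) ⟨
    x ^ p + y ^ p + p × binomialRemainder p x y
      ∎
    where
    monomial : Fin n → Carrier
    monomial j = x ^ suc (toℕ j) * y ^ (n ∸ toℕ j)
    quotientTerm : Fin n → Carrier
    quotientTerm j = ((p C suc (toℕ j)) / p) × monomial j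
    divisible : ∀ j → (p C suc (toℕ j)) × monomial j ≈ p × quotientTerm j
    divisible j = trans (×-congˡ (≡.sym (m*[n/m]≡n (prime∣pCk p-prime z<s (s<s (toℕ<n j))))))
                        (sym (×-assocˡ (monomial j) p ((p C suc (toℕ j)) / p)))

  isPowerSum-binomialRemainder : ∀ p .{{_ : NonZero p}} → IsPowerSum f → IsPowerSum g →
                                 IsPowerSum (λ m → binomialRemainder p (f m) (g m))
  isPowerSum-binomialRemainder p f-ps g-ps = isPowerSum-sum (ℕ.pred p) λ j →
    isPowerSum-× ((p C suc (toℕ j)) / p)
      (isPowerSum-* (isPowerSum-^ (suc (toℕ j)) f-ps) (isPowerSum-^ (ℕ.pred p ∸ toℕ j) g-ps))

  record FrobeniusCongruence (p : ℕ) (f : ℕ → Carrier) : Set (c ⊔ ℓ) where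
    field
      quotient            : ℕ → Carrier
      quotient-isPowerSum : IsPowerSum quotient
      congruence          : ∀ m → .{{_ : NonZero m}} → f m ^ p ≈ f (p ℕ.* m) + p × quotient m

  frobenius-resp : ∀ {p} .{{_ : NonZero p}} →
                   f ≈⁺ g → FrobeniusCongruence p f → FrobeniusCongruence p g
  frobenius-resp {p = p} f≈g F = record
    { quotient            = quotient
    ; quotient-isPowerSum = quotient-isPowerSum
    ; congruence          = λ m → trans (^-congˡ p (sym (f≈g m)))
                                        (trans (congruence m) (+-congʳ (f≈g (p ℕ.* m) {{m*n≢0 p m}})))
    }
    where open FrobeniusCongruence F

  frobenius-0 : ∀ p .{{_ : NonZero p}} → FrobeniusCongruence p (λ _ → 0#)
  frobenius-0 p = record
    { quotient            = λ _ → 0#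
    ; quotient-isPowerSum = isPowerSum-0
    ; congruence          = λ m → trans (0#^n≈0# p)
                                        (sym (trans (+-congˡ (×-zeroʳ p)) (+-identityʳ 0#)))
    }

  frobenius-exp : ∀ p α → FrobeniusCongruence p (α ^_)
  frobenius-exp p α = record
    { quotient            = λ _ → 0#
    ; quotient-isPowerSum = isPowerSum-0
    ; congruence          = λ m → begin
        (α ^ m) ^ p            ≈⟨ ^-assocʳ α m p ⟩
        α ^ (m ℕ.* p)          ≡⟨ ≡.cong (α ^_) (ℕ.*-comm m p) ⟩
        α ^ (p ℕ.* m)          ≈⟨ +-identityʳ _ ⟨
        α ^ (p ℕ.* m) + 0#     ≈⟨ +-congˡ (×-zeroʳ p) ⟨
        α ^ (p ℕ.* m) + p × 0# ∎
    }

  module _ {p : ℕ} (p-prime : Prime p) where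
    private instance
      p-nonZero : NonZero p
      p-nonZero = prime⇒nonZero p-prime

    frobenius-+ : IsPowerSum f → IsPowerSum g → FrobeniusCongruence p f → FrobeniusCongruence p g →
                  FrobeniusCongruence p (λ m → f m + g m)
    frobenius-+ {f} {g} f-ps g-ps F G = record
      { quotient            = quotient
      ; quotient-isPowerSum = isPowerSum-+ (isPowerSum-+ F.quotient-isPowerSum G.quotient-isPowerSum)
                                           (isPowerSum-binomialRemainder p f-ps g-ps)
      ; congruence          = congruence
      }
      where
      module F = FrobeniusCongruence F
      module G = FrobeniusCongruence G
      quotient : ℕ → Carrier
      quotient m = F.quotient m + G.quotient m + binomialRemainder p (f m) (g m)
      congruence : ∀ m → .{{_ : NonZero m}} →
                   (f m + g m) ^ p ≈ f (p ℕ.* m) + g (p ℕ.* m) + p × quotient m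
      congruence m = begin
        (f m + g m) ^ p                             ≈⟨ binomial-prime p-prime (f m) (g m) ⟩
        f m ^ p + g m ^ p + p × r                   ≈⟨ +-congʳ (+-cong (F.congruence m)
                                                                       (G.congruence m)) ⟩
        (f pm + p × s) + (g pm + p × t) + p × r     ≈⟨ +-congʳ (interchange _ _ _ _) ⟩
        (f pm + g pm) + (p × s + p × t) + p × r     ≈⟨ +-assoc _ _ _ ⟩
        (f pm + g pm) + ((p × s + p × t) + p × r)   ≈⟨ +-congˡ (+-congʳ (×-distrib-+ s t p)) ⟨
        (f pm + g pm) + (p × (s + t) + p × r)       ≈⟨ +-congˡ (×-distrib-+ (s + t) r p) ⟨
        (f pm + g pm) + p × (s + t + r)             ∎
        where
        pm = p ℕ.* m
        s = F.quotient m
        t = G.quotient m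
        r = binomialRemainder p (f m) (g m)

    frobenius-neg : IsPowerSum f → FrobeniusCongruence p f → FrobeniusCongruence p (λ m → - f m)
    frobenius-neg {f} f-ps F = record
      { quotient            = quotient
      ; quotient-isPowerSum = isPowerSum-neg (isPowerSum-+ F.quotient-isPowerSum
                                (isPowerSum-binomialRemainder p f-ps (isPowerSum-neg f-ps)))
      ; congruence          = congruence
      }
      where
      module F = FrobeniusCongruence F
      quotient : ℕ → Carrier
      quotient m = - (F.quotient m + binomialRemainder p (f m) (- f m))
      congruence : ∀ m → .{{_ : NonZero m}} → (- f m) ^ p ≈ - f (p ℕ.* m) + p × quotient m
      congruence m = begin
        (- f m) ^ p                  ≈⟨ +-inverseˡ-unique _ _ vanishing ⟩
        - (f m ^ p + p × r)          ≈⟨ -‿cong (+-congʳ (F.congruence m)) ⟩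
        - (f pm + p × s + p × r)     ≈⟨ -‿cong (+-assoc _ _ _) ⟩
        - (f pm + (p × s + p × r))   ≈⟨ -‿cong (+-congˡ (×-distrib-+ s r p)) ⟨
        - (f pm + p × (s + r))       ≈⟨ -‿+-comm _ _ ⟨
        - f pm + - (p × (s + r))     ≈⟨ +-congˡ (×-neg p (s + r)) ⟨
        - f pm + p × (- (s + r))     ∎
        where
        pm = p ℕ.* m
        s = F.quotient m
        r = binomialRemainder p (f m) (- f m)
        vanishing : (- f m) ^ p + (f m ^ p + p × r) ≈ 0#
        vanishing = begin
          (- f m) ^ p + (f m ^ p + p × r) ≈⟨ xy∙z≈y∙xz _ _ _ ⟨
          f m ^ p + (- f m) ^ p + p × r   ≈⟨ binomial-prime p-prime (f m) (- f m) ⟨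
          (f m + - f m) ^ p               ≈⟨ ^-congˡ p (-‿inverseʳ (f m)) ⟩
          0# ^ p                          ≈⟨ 0#^n≈0# p ⟩
          0#                              ∎

    frobeniusCongruence : IsPowerSum f → FrobeniusCongruence p f
    frobeniusCongruence = isPowerSum-ind (FrobeniusCongruence p)
      frobenius-resp (frobenius-0 p) (frobenius-exp p) frobenius-+ frobenius-neg

  -- Roots of unity

  ^≈1⇒^[k*n]≈1 : ∀ {x} n → x ^ n ≈ 1# → ∀ k → x ^ (k ℕ.* n) ≈ 1#
  ^≈1⇒^[k*n]≈1 {x} n xⁿ≈1 k = begin
    x ^ (k ℕ.* n) ≡⟨ ≡.cong (x ^_) (ℕ.*-comm k n) ⟩
    x ^ (n ℕ.* k) ≈⟨ ^-assocʳ x n k ⟨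
    (x ^ n) ^ k   ≈⟨ ^-congˡ k xⁿ≈1 ⟩
    1# ^ k        ≈⟨ 1#^n≈1# k ⟩
    1#            ∎

  ^≈1∧^[1+m]≈1⇒≈1 : ∀ {x m} → x ^ m ≈ 1# → x ^ suc m ≈ 1# → x ≈ 1#
  ^≈1∧^[1+m]≈1⇒≈1 {x} xᵐ≈1 x¹⁺ᵐ≈1 =
    trans (sym (*-identityʳ x)) (trans (*-congˡ (sym xᵐ≈1)) x¹⁺ᵐ≈1)

  ^≈1-coprime⇒≈1 : ∀ {x a b} → Coprime a b → x ^ a ≈ 1# → x ^ b ≈ 1# → x ≈ 1#
  ^≈1-coprime⇒≈1 {x} {a} {b} a⊥b xᵃ≈1 xᵇ≈1 with coprime-Bézout a⊥b
  ... | Bézout.+- i j eq = ^≈1∧^[1+m]≈1⇒≈1 {m = j ℕ.* b} (^≈1⇒^[k*n]≈1 b xᵇ≈1 j)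
                             (trans (^-congʳ x eq) (^≈1⇒^[k*n]≈1 a xᵃ≈1 i))
  ... | Bézout.-+ i j eq = ^≈1∧^[1+m]≈1⇒≈1 {m = i ℕ.* a} (^≈1⇒^[k*n]≈1 a xᵃ≈1 i)
                             (trans (^-congʳ x eq) (^≈1⇒^[k*n]≈1 b xᵇ≈1 j))

  geometric : ℕ → Carrier → Carrier
  geometric n ω = ∑[ i < n ] (ω ^ toℕ i)

  geometric-cong : ∀ n {ω ω′} → ω ≈ ω′ → geometric n ω ≈ geometric n ω′
  geometric-cong n ω≈ω′ = sum-cong-≋ {n} λ i → ^-congˡ (toℕ i) ω≈ω′

  geometric-suc : ∀ n ω → geometric (suc n) ω ≈ 1# + ω * geometric n ω
  geometric-suc n ω = +-congˡ (sym (*-distribˡ-sum {n} ω (λ i → ω ^ toℕ i)))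

  geometric-snoc : ∀ n ω → geometric (suc n) ω ≈ geometric n ω + ω ^ n
  geometric-snoc n ω = trans (sum-init-last {n} (λ i → ω ^ toℕ i))
    (+-cong (sum-cong-≋ {n} λ i → ^-congʳ ω (toℕ-inject₁ i)) (^-congʳ ω (toℕ-fromℕ n)))

  geometric-1# : ∀ n → geometric n 1# ≈ n × 1#
  geometric-1# zero    = refl
  geometric-1# (suc n) = trans (geometric-suc n 1#) (+-congˡ (trans (*-identityˡ _) (geometric-1# n)))

  *-geometric : ∀ n ω → (ω - 1#) * geometric n ω + 1# ≈ ω ^ n
  *-geometric zero    ω = trans (+-congʳ (zeroʳ _)) (+-identityˡ 1#)
  *-geometric (suc n) ω = begin
    (ω - 1#) * geometric (suc n) ω + 1#       ≈⟨ +-congʳ (*-congˡ (geometric-suc n ω)) ⟩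
    (ω - 1#) * (1# + ω * G) + 1#              ≈⟨ +-congʳ (distribˡ _ _ _) ⟩
    ((ω - 1#) * 1# + (ω - 1#) * (ω * G)) + 1# ≈⟨ +-congʳ (+-cong (*-identityʳ _)
                                                                 (*-x∙yz≈y∙xz _ _ _)) ⟩
    ((ω - 1#) + ω * ((ω - 1#) * G)) + 1#      ≈⟨ xy∙z≈y∙xz _ _ _ ⟩
    ω * ((ω - 1#) * G) + ((ω - 1#) + 1#)      ≈⟨ +-congˡ ω-1+1≈ω ⟩
    ω * ((ω - 1#) * G) + ω                    ≈⟨ +-congˡ (*-identityʳ ω) ⟨
    ω * ((ω - 1#) * G) + ω * 1#               ≈⟨ distribˡ _ _ _ ⟨
    ω * ((ω - 1#) * G + 1#)                   ≈⟨ *-congˡ (*-geometric n ω) ⟩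
    ω * ω ^ n                                 ∎
    where
    G = geometric n ω
    ω-1+1≈ω : (ω - 1#) + 1# ≈ ω
    ω-1+1≈ω = trans (+-assoc _ _ _) (trans (+-congˡ (-‿inverseˡ 1#)) (+-identityʳ ω))

  module _ (K-field : IsField K) where
    x≉0∧x*y≈0⇒y≈0 : ∀ {x y} → ¬ x ≈ 0# → x * y ≈ 0# → y ≈ 0#
    x≉0∧x*y≈0⇒y≈0 {x} {y} x≉0 xy≈0 with proj₂ K-field x x≉0
    ... | x⁻¹ , x*x⁻¹≈1 = begin
      y             ≈⟨ *-identityˡ y ⟨
      1# * y        ≈⟨ *-congʳ (trans (*-comm x⁻¹ x) x*x⁻¹≈1) ⟨
      x⁻¹ * x * y   ≈⟨ *-assoc x⁻¹ x y ⟩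
      x⁻¹ * (x * y) ≈⟨ *-congˡ xy≈0 ⟩
      x⁻¹ * 0#      ≈⟨ zeroʳ x⁻¹ ⟩
      0#            ∎

    geometric-rootOfUnity : ∀ n {ω} → ω ^ n ≈ 1# → ¬ ω ≈ 1# → geometric n ω ≈ 0#
    geometric-rootOfUnity n {ω} ωⁿ≈1 ω≉1 =
      x≉0∧x*y≈0⇒y≈0 (ω≉1 ∘ x∙y⁻¹≈ε⇒x≈y ω 1#)
                    (+-identityˡ-unique _ 1# (trans (*-geometric n ω) ωⁿ≈1))

  module _ (K-closed : AlgClosed K) where
    nthRoot : ∀ n .{{_ : NonZero n}} α → Σ[ β ∈ Carrier ] β ^ n ≈ α
    nthRoot (suc n) α = β , x∙y⁻¹≈ε⇒x≈y _ _ (begin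
      β ^ suc n - α
        ≈⟨ +-cong (reflexive (pow≡^ β (suc n))) lower-terms ⟨
      pow K β (suc n) + sumFin K (suc n) (λ i → a i * pow K β (toℕ i))
        ≈⟨ proj₂ (K-closed n a) ⟩
      0#
        ∎)
      where
      a : Fin (suc n) → Carrier
      a zero    = - α
      a (suc _) = 0#
      β = proj₁ (K-closed n a)
      lower-terms : sumFin K (suc n) (λ i → a i * pow K β (toℕ i)) ≈ - α
      higher-terms≈0 : sumFin K n (λ i → 0# * pow K β (suc (toℕ i))) ≈ 0#
      higher-terms≈0 = trans (reflexive (sumFin≡sum n _))
                             (trans (sum-cong-≋ {n} λ _ → zeroˡ _) (sum-replicate-zero n))
      lower-terms = trans (+-congˡ higher-terms≈0) (trans (+-identityʳ _) (*-identityʳ (- α)))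

    geometric-root : ∀ n → Σ[ ζ ∈ Carrier ] geometric (suc (suc n)) ζ ≈ 0#
    geometric-root n = ζ , (begin
      geometric (suc (suc n)) ζ
        ≈⟨ geometric-snoc (suc n) ζ ⟩
      geometric (suc n) ζ + ζ ^ suc n
        ≈⟨ +-comm _ _ ⟩
      ζ ^ suc n + geometric (suc n) ζ
        ≈⟨ +-cong (reflexive (pow≡^ ζ (suc n))) lower-terms ⟨
      pow K ζ (suc n) + sumFin K (suc n) (λ i → 1# * pow K ζ (toℕ i))
        ≈⟨ proj₂ (K-closed n (λ _ → 1#)) ⟩
      0#
        ∎)
      where
      ζ = proj₁ (K-closed n (λ _ → 1#))
      lower-terms : sumFin K (suc n) (λ i → 1# * pow K ζ (toℕ i)) ≈ geometric (suc n) ζ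
      lower-terms = trans (reflexive (sumFin≡sum (suc n) (λ i → 1# * pow K ζ (toℕ i))))
                          (sum-cong-≋ {suc n} λ i → trans (*-identityˡ _)
                                                          (reflexive (pow≡^ ζ (toℕ i))))

  record NontrivialRootOfUnity (n : ℕ) : Set (c ⊔ ℓ) where
    field
      ζ     : Carrier
      ζ^n≈1 : ζ ^ n ≈ 1#
      ζ≉1   : ¬ ζ ≈ 1#

  nontrivialRootOfUnity : AlgClosed K → CharZero K →
                          ∀ n .{{_ : NonTrivial n}} → NontrivialRootOfUnity n
  nontrivialRootOfUnity K-closed K-charZero n@(suc (suc k)) = record
    { ζ     = ζ
    ; ζ^n≈1 = trans (sym (*-geometric n ζ))
                    (trans (+-congʳ (trans (*-congˡ Gζ≈0) (zeroʳ _))) (+-identityˡ 1#))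
    ; ζ≉1   = λ ζ≈1 → K-charZero (suc k) (begin
        natMul K n 1#  ≡⟨ natMul≡× n 1# ⟩
        n × 1#         ≈⟨ geometric-1# n ⟨
        geometric n 1# ≈⟨ geometric-cong n ζ≈1 ⟨
        geometric n ζ  ≈⟨ Gζ≈0 ⟩
        0#             ∎)
    }
    where
    ζ = proj₁ (geometric-root K-closed k)
    Gζ≈0 = proj₂ (geometric-root K-closed k)

  -- The Verschiebung

  record Verschiebung (p : ℕ) (s : ℕ → Carrier) : Set (c ⊔ ℓ) where
    field
      V             : ℕ → Carrier
      V-isPowerSum  : IsPowerSum V
      V-multiple    : ∀ m → .{{_ : NonZero m}} → V (p ℕ.* m) ≈ p × s m
      V-nonmultiple : ∀ m → p ∤ m → V m ≈ 0#

  verschiebung-resp : ∀ {p} → f ≈⁺ g → Verschiebung p f → Verschiebung p g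
  verschiebung-resp {p = p} f≈g 𝕍 = record
    { V             = V
    ; V-isPowerSum  = V-isPowerSum
    ; V-multiple    = λ m → trans (V-multiple m) (×-congʳ p (f≈g m))
    ; V-nonmultiple = V-nonmultiple
    }
    where open Verschiebung 𝕍

  verschiebung-0 : ∀ p → Verschiebung p (λ _ → 0#)
  verschiebung-0 p = record
    { V             = λ _ → 0#
    ; V-isPowerSum  = isPowerSum-0
    ; V-multiple    = λ _ → sym (×-zeroʳ p)
    ; V-nonmultiple = λ _ _ → refl
    }

  verschiebung-+ : ∀ {p} → Verschiebung p f → Verschiebung p g → Verschiebung p (λ m → f m + g m)
  verschiebung-+ {f} {g} {p} 𝕍 𝕎 = record
    { V             = λ m → 𝕍.V m + 𝕎.V m
    ; V-isPowerSum  = isPowerSum-+ 𝕍.V-isPowerSum 𝕎.V-isPowerSum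
    ; V-multiple    = λ m → trans (+-cong (𝕍.V-multiple m) (𝕎.V-multiple m))
                                  (sym (×-distrib-+ (f m) (g m) p))
    ; V-nonmultiple = λ m p∤m → trans (+-cong (𝕍.V-nonmultiple m p∤m) (𝕎.V-nonmultiple m p∤m))
                                      (+-identityʳ 0#)
    }
    where
    module 𝕍 = Verschiebung 𝕍
    module 𝕎 = Verschiebung 𝕎

  verschiebung-neg : ∀ {p} → Verschiebung p f → Verschiebung p (λ m → - f m)
  verschiebung-neg {f} {p} 𝕍 = record
    { V             = λ m → - V m
    ; V-isPowerSum  = isPowerSum-neg V-isPowerSum
    ; V-multiple    = λ m → trans (-‿cong (V-multiple m)) (sym (×-neg p (f m)))
    ; V-nonmultiple = λ m p∤m → trans (-‿cong (V-nonmultiple m p∤m)) -0#≈0#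
    }
    where open Verschiebung 𝕍

  module _ (K-field : IsField K) (K-charZero : CharZero K) (K-closed : AlgClosed K)
           {p : ℕ} (p-prime : Prime p) where
    private instance
      p-nonZero : NonZero p
      p-nonZero = prime⇒nonZero p-prime
      p-nonTrivial : NonTrivial p
      p-nonTrivial = prime⇒nonTrivial p-prime

    open NontrivialRootOfUnity (nontrivialRootOfUnity K-closed K-charZero p)

    geometric-ζ^multiple : ∀ {m} → p ∣ m → geometric p (ζ ^ m) ≈ p × 1#
    geometric-ζ^multiple (divides q m≡q*p) =
      trans (geometric-cong p (trans (^-congʳ ζ m≡q*p) (^≈1⇒^[k*n]≈1 p ζ^n≈1 q)))
            (geometric-1# p)

    geometric-ζ^nonmultiple : ∀ {m} → p ∤ m → geometric p (ζ ^ m) ≈ 0#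
    geometric-ζ^nonmultiple {m} p∤m = geometric-rootOfUnity K-field p ζᵐ^p≈1 ζᵐ≉1
      where
      ζᵐ^p≈1 : (ζ ^ m) ^ p ≈ 1#
      ζᵐ^p≈1 = trans (^-comm ζ m p) (trans (^-congˡ m ζ^n≈1) (1#^n≈1# m))
      ζᵐ≉1 : ¬ ζ ^ m ≈ 1#
      ζᵐ≉1 ζᵐ≈1 = ζ≉1 (^≈1-coprime⇒≈1 (prime∤⇒coprime p-prime p∤m) ζ^n≈1 ζᵐ≈1)

    verschiebung-exp : ∀ α → Verschiebung p (α ^_)
    verschiebung-exp α = record
      { V             = V
      ; V-isPowerSum  = isPowerSum-resp sum-over-roots≈V
                                        (isPowerSum-sum p λ j → isPowerSum-exp (ζ ^ toℕ j * β))
      ; V-multiple    = V-multiple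
      ; V-nonmultiple = λ m p∤m → trans (*-congˡ (geometric-ζ^nonmultiple p∤m)) (zeroʳ _)
      }
      where
      β = proj₁ (nthRoot K-closed p α)
      β^p≈α = proj₂ (nthRoot K-closed p α)
      V : ℕ → Carrier
      V m = β ^ m * geometric p (ζ ^ m)
      sum-over-roots≈V : (λ m → ∑[ j < p ] ((ζ ^ toℕ j * β) ^ m)) ≈⁺ V
      sum-over-roots≈V m = trans (sum-cong-≋ {p} term≈) (sym (*-distribˡ-sum {p} (β ^ m) _))
        where
        term≈ : ∀ j → (ζ ^ toℕ j * β) ^ m ≈ β ^ m * (ζ ^ m) ^ toℕ j
        term≈ j = trans (^-distrib-* _ β m) (trans (*-comm _ _) (*-congˡ (^-comm ζ (toℕ j) m)))
      V-multiple : ∀ m → .{{_ : NonZero m}} → V (p ℕ.* m) ≈ p × α ^ m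
      V-multiple m = begin
        β ^ (p ℕ.* m) * geometric p (ζ ^ (p ℕ.* m)) ≈⟨ *-cong (^-assocʳ β p m)
                                                              (sym (geometric-ζ^multiple (m∣m*n m))) ⟨
        (β ^ p) ^ m * (p × 1#)                      ≈⟨ *-congʳ (^-congˡ m β^p≈α) ⟩
        α ^ m * (p × 1#)                            ≈⟨ *-comm _ _ ⟩
        (p × 1#) * α ^ m                            ≈⟨ ×-assoc-* p 1# (α ^ m) ⟩
        p × (1# * α ^ m)                            ≈⟨ ×-congʳ p (*-identityˡ _) ⟩
        p × α ^ m                                   ∎

    verschiebung : IsPowerSum f → Verschiebung p f
    verschiebung = isPowerSum-ind (Verschiebung p)
      verschiebung-resp (verschiebung-0 p) verschiebung-exp
      (λ _ _ → verschiebung-+) (λ _ → verschiebung-neg)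

  fN≡ : ∀ N f m {l e} → lcm N m ≡ l → gcd N m ≡ e → fN K N f m ≡ pow K (f l) e
  fN≡ N f m ≡.refl ≡.refl = ≡.refl

  fN-1 : ∀ f m .{{_ : NonZero m}} → fN K 1 f m ≈ f m
  fN-1 f m = trans (reflexive (fN≡ 1 f m (lcm[1,n]≡n m) (gcd-zeroˡ m))) (*-identityʳ (f m))

  fN-coprime : ∀ {c m} M f .{{_ : NonZero m}} → Coprime c m →
               fN K (c ℕ.* M) f m ≡ fN K M (λ k → f (c ℕ.* k)) m
  fN-coprime {c} {m} M f c⊥m = fN≡ (c ℕ.* M) f m (lcm[cm,n]≡c*lcm[m,n] M c⊥m) (gcd[cm,n]≡gcd[m,n] M c⊥m)

  fN-* : ∀ c M f m .{{_ : NonZero c}} .{{_ : NonZero m}} →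
         fN K (c ℕ.* M) f (c ℕ.* m) ≈ fN K M (λ k → f (c ℕ.* k)) m ^ c
  fN-* c M f m = begin
    fN K (c ℕ.* M) f (c ℕ.* m) ≡⟨ fN≡ (c ℕ.* M) f (c ℕ.* m) (lcm[cm,cn]≡c*lcm[m,n] c M m)
                                      (≡.sym (c*gcd[m,n]≡gcd[cm,cn] c M m)) ⟩
    pow K x (c ℕ.* gcd M m)    ≡⟨ pow≡^ x (c ℕ.* gcd M m) ⟩
    x ^ (c ℕ.* gcd M m)        ≡⟨ ≡.cong (x ^_) (ℕ.*-comm c (gcd M m)) ⟩
    x ^ (gcd M m ℕ.* c)        ≈⟨ ^-assocʳ x (gcd M m) c ⟨
    (x ^ gcd M m) ^ c          ≡⟨ ≡.cong (_^ c) (pow≡^ x (gcd M m)) ⟨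
    pow K x (gcd M m) ^ c      ∎
    where x = f (c ℕ.* lcm M m)

  PreservesPowerSums : ℕ → Set (c ⊔ ℓ)
  PreservesPowerSums N = ∀ {f} → IsPowerSum f → IsPowerSum (fN K N f)

  preservesPowerSums-1 : PreservesPowerSums 1
  preservesPowerSums-1 {f} = isPowerSum-resp λ m → sym (fN-1 f m)

  module _ (K-field : IsField K) (K-charZero : CharZero K) (K-closed : AlgClosed K) where
    preservesPowerSums-* : ∀ {p M} → Prime p → PreservesPowerSums M → PreservesPowerSums (p ℕ.* M)
    preservesPowerSums-* {p} {M} p-prime M-preserves {f} f-ps =
      isPowerSum-resp decomposition (isPowerSum-+ h-ps V-isPowerSum)
      where
      instance
        p-nonZero : NonZero p
        p-nonZero = prime⇒nonZero p-prime
      h : ℕ → Carrier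
      h = fN K M (λ k → f (p ℕ.* k))
      h-ps : IsPowerSum h
      h-ps = M-preserves (isPowerSum-∘* p f-ps)
      open FrobeniusCongruence (frobeniusCongruence p-prime h-ps)
      open Verschiebung (verschiebung K-field K-charZero K-closed p-prime quotient-isPowerSum)
      on-multiples : ∀ q .{{_ : NonZero q}} →
                     h (p ℕ.* q) + V (p ℕ.* q) ≈ fN K (p ℕ.* M) f (p ℕ.* q)
      on-multiples q = begin
        h (p ℕ.* q) + V (p ℕ.* q)      ≈⟨ +-congˡ (V-multiple q) ⟩
        h (p ℕ.* q) + p × quotient q   ≈⟨ congruence q ⟨
        h q ^ p                        ≈⟨ fN-* p M f q ⟨
        fN K (p ℕ.* M) f (p ℕ.* q)     ∎
      decomposition : (λ m → h m + V m) ≈⁺ fN K (p ℕ.* M) f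
      decomposition m with p ∣? m
      ... | no p∤m = begin
        h m + V m              ≈⟨ +-congˡ (V-nonmultiple m p∤m) ⟩
        h m + 0#               ≈⟨ +-identityʳ (h m) ⟩
        h m                    ≡⟨ fN-coprime M f (prime∤⇒coprime p-prime p∤m) ⟨
        fN K (p ℕ.* M) f m     ∎
      ... | yes (divides q ≡.refl) =
        ≡.subst (λ n → h n + V n ≈ fN K (p ℕ.* M) f n) (ℕ.*-comm p q)
                (on-multiples q {{m*n≢0⇒m≢0 q}})

    preservesPowerSums-product : ∀ {ps} → All Prime ps → PreservesPowerSums (product ps)
    preservesPowerSums-product []                    = preservesPowerSums-1
    preservesPowerSums-product (p-prime ∷ ps-primes) =
      preservesPowerSums-* p-prime (preservesPowerSums-product ps-primes)

proposition2p3 : {c ℓ : Level} (K : CommutativeRing c ℓ) →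
    IsField K → CharZero K → AlgClosed K →
    (N : ℕ) → .{{_ : NonZero N}} →
    (f : ℕ → CommutativeRing.Carrier K) →
    IsLefschetzType K f → IsLefschetzType K (fN K N f)
proposition2p3 K K-field K-charZero K-closed N f f-lefschetz =
  isPowerSum⇒isLefschetzType K (≡.subst (λ n → IsPowerSum K (fN K n f)) (≡.sym isFactorisation)
    (preservesPowerSums-product K K-field K-charZero K-closed factorsPrime
      (isLefschetzType⇒isPowerSum K f-lefschetz)))
  where open PrimeFactorisation (factorise N)
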